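{- An HDA $\mathcal{A}$ satisfies condition HM3 (for all $m\ge2$ and all $x,y\in(P_\mathcal{A})_m$, if $d^k_rx=d^k_ry$ for all $r\in\{1,\dots,m\}$ and $k\in\{0,1\}$, then $x=y$) if and only if for all $m\in\mathbb{N}$ the map $(P_\mathcal{A})_m\to\mathsf{PCS}(\llbracket0,1\rrbracket^{\otimes m}_{\le1},(P_\mathcal{A})_{\le1})$, $x\mapsto(x_\sharp)_{\le1}$, is injective.
   Context: A precubical set $P$ is a family of sets $(P_n)_{n\ge0}$ with face maps $d^k_i:P_n\to P_{n-1}$ ($n>0$, $k\in\{0,1\}$, $1\le i\le n$) satisfying $d^k_id^l_j=d^l_{j-1}d^k_i$ for $i<j$; morphisms are degree-preserving maps commuting with faces, and $\mathsf{PCS}(X,Y)$ denotes the set of morphisms $X\to Y$. The $n$-skeleton $P_{\le n}$ keeps the cubes of degree $\le n$; for a morphism $f$, $f_{\le n}$ is its restriction. The tensor product $P\otimes Q$ has $(P\otimes Q)_n=\coprod_{p+q=n}P_p\times Q_q$ and, for $(x,y)\in P_p\times Q_q$, $d^k_i(x,y)=(d^k_ix,y)$ if $i\le p$ and $(x,d^k_{i-p}y)$ if $p<i\le p+q$. The interval $\llbracket0,1\rrbracket$ has vertices $0,1$ and one edge $[0,1]$ with $d^0_1[0,1]=0$, $d^1_1[0,1]=1$. The precubical $m$-cube $\llbracket0,1\rrbracket^{\otimes m}$ is the $m$-fold tensor product ($\llbracket0,1\rrbracket^{\otimes0}$ is a single vertex), whose unique $m$-cube is $\iota_m$. For $x\in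 P_m$, $x_\sharp:\llbracket0,1\rrbracket^{\otimes m}\to P$ is the unique morphism with $x_\sharp(\iota_m)=x$. An HDA $\mathcal{A}=(P_\mathcal{A},I_\mathcal{A},F_\mathcal{A},\Sigma_\mathcal{A},\lambda_\mathcal{A})$ consists of a precubical set, an initial vertex, a set of final vertices, a label set and a labeling $\lambda_\mathcal{A}:(P_\mathcal{A})_1\to\Sigma_\mathcal{A}$ with $\lambda_\mathcal{A}(d^0_ix)=\lambda_\mathcal{A}(d^1_ix)$ for all 2-cubes $x$ and $i=1,2$. -}

module Defs where

open import Data.Nat using (ℕ; zero; suc; _+_; _≤_)
open import Data.Nat.Properties using (+-suc; ≤-trans; n≤1+n)
open import Data.Fin using (Fin; toℕ; fromℕ; inject₁; splitAt; _↑ˡ_)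
open import Data.Bool using (Bool; true; false)
open import Data.Unit using (⊤; tt)
open import Data.Empty using (⊥)
open import Data.Sum using (_⊎_; inj₁; inj₂)
open import Data.Product using (Σ; Σ-syntax; _×_; _,_)
open import Relation.Binary.PropositionalEquality using (_≡_; refl; sym; trans; cong; subst)

-- Conventions.
--  * k ∈ {0,1} is a Bool (false = 0, true = 1).
--  * Face indices are 0-based: for j : Fin (suc n),
--      face P k j : Cell P (suc n) → Cell P n
--    is the paper's d^k_{j+1} : P_{n+1} → P_n  (so 1 ≤ j+1 ≤ n+1).

record PreCubicalData : Set₁ where
  field
    Cell : ℕ → Set
    face : ∀ {n} → Bool → Fin (suc n) → Cell (suc n) → Cell n

open PreCubicalData public

-- The precubical identities  d^k_i d^l_j = d^l_{j-1} d^k_i  (i < j)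
-- on x ∈ P_{n+2}.  0-based: the paper's i is (i+1) with i : Fin (suc n),
-- the paper's j is (suc j)+1 with j : Fin (suc n); i < j (paper) iff
-- toℕ i ≤ toℕ j.
IsPrecubical : PreCubicalData → Set
IsPrecubical P =
  ∀ {n} (k l : Bool) (i j : Fin (suc n)) → toℕ i ≤ toℕ j →
  (x : Cell P (suc (suc n))) →
  face P k i (face P l (Fin.suc j) x) ≡ face P l j (face P k (inject₁ i) x)

CellMap : PreCubicalData → PreCubicalData → Set
CellMap X Y = ∀ {n} → Cell X n → Cell Y n

record Hom (X Y : PreCubicalData) : Set where
  field
    map  : CellMap X Y
    comm : ∀ {n} (k : Bool) (i : Fin (suc n)) (x : Cell X (suc n)) →
           map (face X k i x) ≡ face Y k i (map x)

EqMap : (X Y : PreCubicalData) → CellMap X Y → CellMap X Y → Set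
EqMap X Y f g = ∀ n (c : Cell X n) → f c ≡ g c

Skel : PreCubicalData → ℕ → PreCubicalData
Cell (Skel P n) m = (m ≤ n) × Cell P m
face (Skel P n) {m} k i (h , x) = ≤-trans (n≤1+n m) h , face P k i x

restrict : ∀ {X Y} (n : ℕ) → CellMap X Y → CellMap (Skel X n) (Skel Y n)
restrict n f (h , x) = h , f x

TCell : PreCubicalData → PreCubicalData → ℕ → Set
TCell P Q n = Σ[ p ∈ ℕ ] Σ[ q ∈ ℕ ] (p + q ≡ n) × Cell P p × Cell Q q

private
  suc-inj : ∀ {a b : ℕ} → suc a ≡ suc b → a ≡ b
  suc-inj refl = refl

  tface : (P Q : PreCubicalData) → ∀ {n} → Bool → (p q : ℕ) → p + q ≡ suc n →
          Cell P p → Cell Q q → Fin p ⊎ Fin q → TCell P Q n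
  tface P Q k zero q eq x y (inj₁ ())
  tface P Q k (suc p) q eq x y (inj₁ i) = p , q , suc-inj eq , face P k i x , y
  tface P Q k p zero eq x y (inj₂ ())
  tface P Q k p (suc q) eq x y (inj₂ j) =
    p , q , suc-inj (trans (sym (+-suc p q)) eq) , x , face Q k j y

_⊗_ : PreCubicalData → PreCubicalData → PreCubicalData
Cell (P ⊗ Q) = TCell P Q
face (P ⊗ Q) k i (p , q , eq , x , y) =
  tface P Q k p q eq x y (splitAt p (subst Fin (sym eq) i))

-- The interval ⟦0,1⟧: vertices 0,1 (false,true), one edge [0,1] (tt).

ICell : ℕ → Set
ICell zero = Bool
ICell (suc zero) = ⊤
ICell (suc (suc _)) = ⊥

Interval : PreCubicalData
Cell Interval = ICell
face Interval {zero} k Fin.zero tt = k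
face Interval {suc _} k i ()

Point : PreCubicalData
Cell Point n = n ≡ 0
face Point k i ()

Cube : ℕ → PreCubicalData
Cube zero = Point
Cube (suc m) = Interval ⊗ Cube m

ι : ∀ m → Cell (Cube m) m
ι zero = refl
ι (suc m) = 1 , m , refl , tt , ι m

-- A cube cell is a word in {0,1,[0,1]}^m; x_♯ applies to x the faces
-- d^b at the positions carrying a vertex b.  Auxiliary: k counts the
-- [0,1]-coordinates already processed (which stay in the result).

sharpAux : (P : PreCubicalData) (m k : ℕ) → Cell P (k + m) →
           ∀ {n} → Cell (Cube m) n → Cell P (k + n)
sharpAux P zero k x eq = subst (λ t → Cell P (k + t)) (sym eq) x
sharpAux P (suc m) k x (zero , q , eq , b , a) =
  subst (λ t → Cell P (k + t)) eq
    (sharpAux P m k (face P b (fromℕ k ↑ˡ m) (subst (Cell P) (+-suc k m) x)) a)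
sharpAux P (suc m) k x (suc zero , q , eq , tt , a) =
  subst (Cell P) (trans (sym (+-suc k q)) (cong (k +_) eq))
    (sharpAux P m (suc k) (subst (Cell P) (+-suc k m) x) a)
sharpAux P (suc m) k x (suc (suc p) , q , eq , () , a)

sharp : (P : PreCubicalData) (m : ℕ) → Cell P m → CellMap (Cube m) P
sharp P m x c = sharpAux P m 0 x c

record HDA : Set₁ where
  field
    P     : PreCubicalData
    P-pcs : IsPrecubical P
    I     : Cell P 0
    F     : Cell P 0 → Set
    Lab   : Set
    lab   : Cell P 1 → Lab
    lab-compat : ∀ (x : Cell P 2) (i : Fin 2) →
                 lab (face P false i x) ≡ lab (face P true i x)

-- Condition HM3 (m ≥ 2 written as m = n + 2).
HM3 : HDA → Set
HM3 A = ∀ n (x y : Cell P (suc (suc n))) →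
        (∀ (k : Bool) (r : Fin (suc (suc n))) → face P k r x ≡ face P k r y) →
        x ≡ y
  where open HDA A

SharpInjective : HDA → Set
SharpInjective A = ∀ m (x y : Cell P m) →
  EqMap (Skel (Cube m) 1) (Skel P 1)
        (restrict {Cube m} {P} 1 (sharp P m x)) (restrict {Cube m} {P} 1 (sharp P m y)) →
  x ≡ y
  where open HDA A

module Submission where

-- The value of x_♯ on a cube cell c is obtained from x by applying the faces
-- prescribed by the vertex coordinates of c.  If c has dimension < m it has a
-- vertex coordinate, so x_♯(c) only depends on a face of x: when m ≥ 2 and all
-- faces of x and y agree, (x_♯)_{≤1} = (y_♯)_{≤1}, so injectivity gives HM3.
-- Conversely the precubical identities give x_♯(δ^b_r c) = (d^b_r x)_♯(c), where
-- δ^b_r inserts the vertex b as r-th coordinate; hence (x_♯)_{≤1} determines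
-- ((d^b_r x)_♯)_{≤1}, and induction on m with HM3 recovers x from (x_♯)_{≤1}.

open import Defs
open import Function.Bundles using (_⇔_; mk⇔)
open import Data.Nat using (ℕ; zero; suc; _+_; _≤_; _<_; z≤n; s≤s; _<?_)
open import Data.Nat.Properties using (+-suc; +-identityʳ; m≤m+n; ≤-trans; ≤-reflexive; +-monoʳ-≤; ≤-pred)
open import Data.Fin using (Fin; toℕ; fromℕ; fromℕ<; inject₁; _↑ˡ_)
open import Data.Fin.Properties using (toℕ-injective; toℕ-fromℕ<; toℕ-inject₁; toℕ-↑ˡ; toℕ-fromℕ; toℕ<n)
open import Data.Bool using (Bool)
open import Data.List using (List; []; _∷_)
open import Data.Product using (Σ; Σ-syntax; _×_; _,_; proj₁; proj₂)
open import Data.Unit using (tt)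
open import Data.Empty using (⊥-elim)
open import Relation.Nullary using (yes; no)
open import Relation.Binary.PropositionalEquality using (_≡_; refl; sym; trans; cong; subst; subst₂; module ≡-Reasoning)

FacesDetermineCubes : PreCubicalData → Set
FacesDetermineCubes P =
  ∀ n (x y : Cell P (suc (suc n))) →
  (∀ (k : Bool) (r : Fin (suc (suc n))) → face P k r x ≡ face P k r y) → x ≡ y

module FaceWords (P : PreCubicalData) where

  -- Cells packed with their degree, and faces indexed by ℕ (the identity out
  -- of range), let face words be evaluated without transport along degrees.
  ∃Cell : Set
  ∃Cell = Σ ℕ (Cell P)

  pack : ∀ {n} → Cell P n → ∃Cell
  pack {n} x = n , x

  pack-injective : ∀ {n} {x y : Cell P n} → pack x ≡ pack y → x ≡ y
  pack-injective refl = refl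

  pack-subst : ∀ {m n} (e : m ≡ n) (x : Cell P m) → pack (subst (Cell P) e x) ≡ pack x
  pack-subst refl x = refl

  faceAt : Bool → ℕ → ∃Cell → ∃Cell
  faceAt b i (zero , x) = zero , x
  faceAt b i (suc n , x) with i <? suc n
  ... | yes i<n = n , face P b (fromℕ< i<n) x
  ... | no _    = suc n , x

  faceAt-face : ∀ b {n} (x : Cell P (suc n)) (i : Fin (suc n)) {j} → toℕ i ≡ j →
                faceAt b j (pack x) ≡ pack (face P b i x)
  faceAt-face b {n} x i {j} i≡j with j <? suc n
  ... | yes j<n = cong (λ i′ → n , face P b i′ x) (toℕ-injective (trans (toℕ-fromℕ< j<n) (sym i≡j)))
  ... | no j≮n  = ⊥-elim (j≮n (subst (_< suc n) i≡j (toℕ<n i)))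

  applyWord : List (Bool × ℕ) → ∃Cell → ∃Cell
  applyWord [] X = X
  applyWord ((b , i) ∷ w) X = applyWord w (faceAt b i X)

  -- k counts the [0,1]-coordinates already read, as in sharpAux.
  faceWord : ∀ m {n} → ℕ → Cell (Cube m) n → List (Bool × ℕ)
  faceWord zero k _ = []
  faceWord (suc m) k (zero , _ , _ , b , c) = (b , k) ∷ faceWord m k c
  faceWord (suc m) k (suc zero , _ , _ , tt , c) = faceWord m (suc k) c
  faceWord (suc m) k (suc (suc _) , _ , _ , () , _)

  sharpAux-faceWord : ∀ m k (x : Cell P (k + m)) {n} (c : Cell (Cube m) n) →
                      pack (sharpAux P m k x c) ≡ applyWord (faceWord m k c) (pack x)
  sharpAux-faceWord zero k x refl = refl
  sharpAux-faceWord (suc m) k x (zero , _ , refl , b , c) =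
    trans (sharpAux-faceWord m k _ c) (cong (applyWord (faceWord m k c)) (sym first-face))
    where
      first-face : faceAt b k (pack x) ≡ pack (face P b (fromℕ k ↑ˡ m) (subst (Cell P) (+-suc k m) x))
      first-face =
        trans (cong (faceAt b k) (sym (pack-subst (+-suc k m) x)))
              (faceAt-face b _ _ (trans (toℕ-↑ˡ (fromℕ k) m) (toℕ-fromℕ k)))
  sharpAux-faceWord (suc m) k x (suc zero , _ , refl , tt , c) =
    trans (pack-subst _ _)
      (trans (sharpAux-faceWord m (suc k) _ c)
             (cong (applyWord (faceWord m (suc k) c)) (pack-subst (+-suc k m) x)))
  sharpAux-faceWord (suc m) k x (suc (suc _) , _ , _ , () , _)

  faceWord-proper : ∀ m k {n} (c : Cell (Cube m) n) → n < m →
                    Σ[ b ∈ Bool ] Σ[ j ∈ ℕ ] Σ[ w ∈ List (Bool × ℕ) ]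
                      faceWord m k c ≡ (b , j) ∷ w × j < k + m
  faceWord-proper (suc m) k (zero , _ , refl , b , c) _ =
    b , k , faceWord m k c , refl , ≤-trans (s≤s (m≤m+n k m)) (≤-reflexive (sym (+-suc k m)))
  faceWord-proper (suc m) k (suc zero , _ , refl , tt , c) (s≤s n<m)
    with faceWord-proper m (suc k) c n<m
  ... | b , j , w , c≡ , j< = b , j , w , c≡ , subst (j <_) (sym (+-suc k m)) j<
  faceWord-proper (suc m) k (suc (suc _) , _ , _ , () , _) _

  sharp-agree-on-proper-cells : ∀ m (x y : Cell P (suc m)) →
    (∀ (k : Bool) (r : Fin (suc m)) → face P k r x ≡ face P k r y) →
    ∀ {d} (c : Cell (Cube (suc m)) d) → d < suc m →
    sharp P (suc m) x c ≡ sharp P (suc m) y c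
  sharp-agree-on-proper-cells m x y faces≡ c d<m = pack-injective (begin
    pack (sharp P (suc m) x c)                ≡⟨ sharpAux-faceWord (suc m) 0 x c ⟩
    applyWord (faceWord (suc m) 0 c) (pack x) ≡⟨ word-agrees (faceWord-proper (suc m) 0 c d<m) ⟩
    applyWord (faceWord (suc m) 0 c) (pack y) ≡⟨ sym (sharpAux-faceWord (suc m) 0 y c) ⟩
    pack (sharp P (suc m) y c)                ∎)
    where
      open ≡-Reasoning
      word-agrees : ∀ {w} → Σ[ b ∈ Bool ] Σ[ j ∈ ℕ ] Σ[ w′ ∈ List (Bool × ℕ) ] w ≡ (b , j) ∷ w′ × j < suc m →
                    applyWord w (pack x) ≡ applyWord w (pack y)
      word-agrees (b , j , w′ , refl , j<) =
        cong (applyWord w′)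
          (trans (faceAt-face b x (fromℕ< j<) (toℕ-fromℕ< j<))
          (trans (cong pack (faces≡ b (fromℕ< j<)))
                 (sym (faceAt-face b y (fromℕ< j<) (toℕ-fromℕ< j<)))))

  insertVertex : ∀ {m n} → Fin (suc m) → Bool → Cell (Cube m) n → Cell (Cube (suc m)) n
  insertVertex {n = n} Fin.zero b c = zero , n , refl , b , c
  insertVertex {zero} (Fin.suc ()) b c
  insertVertex {suc m} (Fin.suc r) b (zero , q , eq , b′ , c) = zero , q , eq , b′ , insertVertex r b c
  insertVertex {suc m} (Fin.suc r) b (suc zero , q , eq , tt , c) = suc zero , q , eq , tt , insertVertex r b c
  insertVertex {suc m} (Fin.suc r) b (suc (suc _) , _ , _ , () , _)

  module _ (pcs : IsPrecubical P) where

    faceAt-swap : ∀ b b′ {i j n} → i ≤ j → j < suc n → (X : ∃Cell) → proj₁ X ≡ suc (suc n) →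
                  faceAt b i (faceAt b′ (suc j) X) ≡ faceAt b′ j (faceAt b i X)
    faceAt-swap b b′ {i} {j} {n} i≤j j<n (_ , x) refl = begin
      faceAt b i (faceAt b′ (suc j) (pack x))  ≡⟨ cong (faceAt b i) (faceAt-face b′ x (Fin.suc J) (cong suc (toℕ-fromℕ< j<n))) ⟩
      faceAt b i (pack (face P b′ (Fin.suc J) x)) ≡⟨ faceAt-face b _ I (toℕ-fromℕ< i<n) ⟩
      pack (face P b I (face P b′ (Fin.suc J) x)) ≡⟨ cong pack (pcs b b′ I J I≤J x) ⟩
      pack (face P b′ J (face P b (inject₁ I) x)) ≡⟨ sym (faceAt-face b′ _ J (toℕ-fromℕ< j<n)) ⟩
      faceAt b′ j (pack (face P b (inject₁ I) x)) ≡⟨ sym (cong (faceAt b′ j) (faceAt-face b x (inject₁ I) (trans (toℕ-inject₁ I) (toℕ-fromℕ< i<n)))) ⟩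
      faceAt b′ j (faceAt b i (pack x))        ∎
      where
        open ≡-Reasoning
        i<n : i < suc n
        i<n = ≤-trans (s≤s i≤j) j<n
        I J : Fin (suc n)
        I = fromℕ< i<n
        J = fromℕ< j<n
        I≤J : toℕ I ≤ toℕ J
        I≤J = subst₂ _≤_ (sym (toℕ-fromℕ< i<n)) (sym (toℕ-fromℕ< j<n)) i≤j

    faceWord-insertVertex : ∀ m k (r : Fin (suc m)) b {n} (c : Cell (Cube m) n) (X : ∃Cell) →
      proj₁ X ≡ suc (k + m) →
      applyWord (faceWord (suc m) k (insertVertex r b c)) X ≡ applyWord (faceWord m k c) (faceAt b (k + toℕ r) X)
    faceWord-insertVertex m k Fin.zero b c X _ =
      cong (λ i → applyWord (faceWord m k c) (faceAt b i X)) (sym (+-identityʳ k))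
    faceWord-insertVertex zero k (Fin.suc ()) b c X _
    faceWord-insertVertex (suc m) k (Fin.suc r) b (zero , _ , _ , b′ , c) (_ , x) refl = begin
      applyWord (faceWord (suc m) k (insertVertex r b c)) (faceAt b′ k (pack x))
        ≡⟨ cong (applyWord (faceWord (suc m) k (insertVertex r b c))) first-face ⟩
      applyWord (faceWord (suc m) k (insertVertex r b c)) (pack x′)
        ≡⟨ faceWord-insertVertex m k r b c (pack x′) (+-suc k m) ⟩
      applyWord (faceWord m k c) (faceAt b (k + toℕ r) (pack x′))
        ≡⟨ cong (λ X → applyWord (faceWord m k c) (faceAt b (k + toℕ r) X)) (sym first-face) ⟩
      applyWord (faceWord m k c) (faceAt b (k + toℕ r) (faceAt b′ k (pack x)))
        ≡⟨ cong (applyWord (faceWord m k c)) (sym (faceAt-swap b′ b (m≤m+n k (toℕ r)) r<m (pack x) (cong suc (+-suc k m)))) ⟩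
      applyWord (faceWord m k c) (faceAt b′ k (faceAt b (suc (k + toℕ r)) (pack x)))
        ≡⟨ cong (λ i → applyWord (faceWord m k c) (faceAt b′ k (faceAt b i (pack x)))) (sym (+-suc k (toℕ r))) ⟩
      applyWord (faceWord m k c) (faceAt b′ k (faceAt b (k + suc (toℕ r)) (pack x))) ∎
      where
        open ≡-Reasoning
        x′ : Cell P (k + suc m)
        x′ = face P b′ (fromℕ k ↑ˡ suc m) x
        first-face : faceAt b′ k (pack x) ≡ pack x′
        first-face = faceAt-face b′ x _ (trans (toℕ-↑ˡ (fromℕ k) (suc m)) (toℕ-fromℕ k))
        r<m : k + toℕ r < suc (k + m)
        r<m = s≤s (+-monoʳ-≤ k (≤-pred (toℕ<n r)))
    faceWord-insertVertex (suc m) k (Fin.suc r) b (suc zero , _ , _ , tt , c) X X≡ =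
      trans (faceWord-insertVertex m (suc k) r b c X (trans X≡ (cong suc (+-suc k m))))
            (cong (λ i → applyWord (faceWord m (suc k) c) (faceAt b i X)) (sym (+-suc k (toℕ r))))
    faceWord-insertVertex (suc m) k (Fin.suc r) b (suc (suc _) , _ , _ , () , _) X _

    sharp-insertVertex : ∀ m (x : Cell P (suc m)) (r : Fin (suc m)) b {n} (c : Cell (Cube m) n) →
                         sharp P (suc m) x (insertVertex r b c) ≡ sharp P m (face P b r x) c
    sharp-insertVertex m x r b c = pack-injective (begin
      pack (sharp P (suc m) x (insertVertex r b c))
        ≡⟨ sharpAux-faceWord (suc m) 0 x (insertVertex r b c) ⟩
      applyWord (faceWord (suc m) 0 (insertVertex r b c)) (pack x)
        ≡⟨ faceWord-insertVertex m 0 r b c (pack x) refl ⟩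
      applyWord (faceWord m 0 c) (faceAt b (toℕ r) (pack x))
        ≡⟨ cong (applyWord (faceWord m 0 c)) (faceAt-face b x r refl) ⟩
      applyWord (faceWord m 0 c) (pack (face P b r x))
        ≡⟨ sym (sharpAux-faceWord m 0 (face P b r x) c) ⟩
      pack (sharp P m (face P b r x) c) ∎)
      where open ≡-Reasoning

    determined-by-sharp-1-skeleton : FacesDetermineCubes P → ∀ m (x y : Cell P m) →
      (∀ n → n ≤ 1 → (c : Cell (Cube m) n) → sharp P m x c ≡ sharp P m y c) → x ≡ y
    determined-by-sharp-1-skeleton hm3 zero x y sharp≡ = sharp≡ 0 z≤n refl
    determined-by-sharp-1-skeleton hm3 (suc zero) x y sharp≡ = sharp≡ 1 (s≤s z≤n) (1 , 0 , refl , tt , refl)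
    determined-by-sharp-1-skeleton hm3 (suc (suc m)) x y sharp≡ =
      hm3 m x y λ b r → determined-by-sharp-1-skeleton hm3 (suc m) _ _ λ n n≤1 c →
        trans (sym (sharp-insertVertex (suc m) x r b c))
              (trans (sharp≡ n n≤1 (insertVertex r b c))
                     (sharp-insertVertex (suc m) y r b c))

proposition4p1 : (A : HDA) → HM3 A ⇔ SharpInjective A
proposition4p1 A = mk⇔ hm3⇒injective injective⇒hm3
  where
    open HDA A
    open FaceWords P

    hm3⇒injective : HM3 A → SharpInjective A
    hm3⇒injective hm3 m x y sharp≡ =
      determined-by-sharp-1-skeleton P-pcs hm3 m x y λ n n≤1 c → cong proj₂ (sharp≡ n (n≤1 , c))

    injective⇒hm3 : SharpInjective A → HM3 A
    injective⇒hm3 injective n x y faces≡ = injective (suc (suc n)) x y λ where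
      d (d≤1 , c) → cong (d≤1 ,_) (sharp-agree-on-proper-cells (suc n) x y faces≡ c (s≤s (≤-trans d≤1 (s≤s z≤n))))
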